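{- Let $n=p+q$, $\sigma\in S_n$, $a=\sigma\mid\{1,\ldots,p\}$ and $b=st(\sigma\mid\{p+1,\ldots,n\})$. Then for all $u\in S_p$ and $v\in S_q$, one has $\sigma\leq v\bigtriangleup u$ if and only if $a\leq u$ and $b\leq v$.
   Context: Permutations are identified with words $\sigma(1)\cdots\sigma(n)$. An inversion of a word without repeated letters is a pair $(j,i)$ with $j>i$ and $j$ to the left of $i$; $\leq$ denotes the right weak order on each $S_m$: $u\leq v$ iff the inversion set of $u$ is contained in that of $v$. For $I\subseteq\{1,\ldots,n\}$, $\sigma\mid I$ is the word obtained from $\sigma$ by deleting letters not in $I$; $st(w)$ is the standardization of a word $w$ without repeated letters (replace letters by their images under the increasing bijection onto $\{1,\ldots,|w|\}$). Note $\sigma\mid\{1,\ldots,p\}$ is a permutation in $S_p$. For $u\in S_p$, $v\in S_q$, $v\bigtriangleup u=\bar v u$ (concatenation), where $\bar v$ is $v$ with $p$ added to each letter. -}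

module Defs where

open import Data.Nat using (ℕ; zero; suc; _+_; _<_; _≤?_; _<?_)
open import Data.List using (List; []; _∷_; _++_; map; filter; length; upTo)
open import Data.List.Relation.Binary.Permutation.Propositional using (_↭_)
open import Data.Product using (Σ-syntax; ∃-syntax; _×_)
open import Relation.Binary.PropositionalEquality using (_≡_)

-- Words are lists of natural numbers; a permutation of S_m is a word that is
-- a rearrangement of 1 2 ... m.
oneTo : ℕ → List ℕ
oneTo m = map suc (upTo m)

IsPerm : ℕ → List ℕ → Set
IsPerm m w = w ↭ oneTo m

Inv : List ℕ → ℕ → ℕ → Set
Inv w j i = i < j × (∃[ xs ] ∃[ ys ] ∃[ zs ] (w ≡ xs ++ (j ∷ ys ++ (i ∷ zs))))

_≤w_ : List ℕ → List ℕ → Set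
u ≤w v = ∀ j i → Inv u j i → Inv v j i

restrictLow : ℕ → List ℕ → List ℕ
restrictLow p σ = filter (λ x → x ≤? p) σ

restrictHigh : ℕ → List ℕ → List ℕ
restrictHigh p σ = filter (λ x → p <? x) σ

st : List ℕ → List ℕ
st w = map (λ x → suc (length (filter (λ y → y <? x) w))) w

_△_ : List ℕ → List ℕ → List ℕ
v △ u = map (λ x → x + length u) v ++ u

-- The weak order compares inversion sets, and every pair (j , i) with j > i
-- falls into one of three classes: both letters in {1..p}, both in
-- {p+1..p+q}, or j high and i low.  In v △ u every high letter precedes every
-- low letter, so all pairs of the third class are inversions of v △ u and
-- impose nothing.  Inversions of the first class are those of the restrictions
-- to {1..p}, and those of the second class are the inversions of the
-- restrictions to {p+1..p+q}.  These restrictions are the shifts by p of b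
-- (σ contains every letter of {p+1..p+q}, so standardizing just subtracts p)
-- and of v, and shifting by p is an order embedding, so it neither creates nor
-- destroys inversions.

module Submission where

open import Defs
open import Data.Nat using (ℕ; suc; _+_; _∸_; _≤_; _<_; _≤?_; _<?_; s≤s; z<s)
open import Data.Nat.Properties
open import Data.List using (List; []; _∷_; _++_; [_]; map; filter; length; upTo)
open import Data.List.Properties
  using (filter-++; filter-all; filter-none; map-++; map-∘; map-cong-local; map-id-local;
         ++-assoc; ++-identityʳ; length-map; length-upTo; upTo-∷ʳ)
open import Data.List.Membership.Propositional using (_∈_)
open import Data.List.Membership.Propositional.Properties
  using (∈-map⁺; ∈-map⁻; ∈-filter⁺; ∈-filter⁻; ∈-upTo⁺; ∈-upTo⁻; ∈-++⁺ʳ; ∈-∃++)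
open import Data.List.Relation.Unary.Any using (here; there)
open import Data.List.Relation.Unary.All as All using (All)
open import Data.List.Relation.Unary.All.Properties using (++⁺) renaming (map⁺ to All-map⁺)
open import Data.List.Relation.Binary.Permutation.Propositional using (↭-sym)
open import Data.List.Relation.Binary.Permutation.Propositional.Properties
  using (∈-resp-↭; ↭-length; filter-↭)
open import Data.Product using (_×_; _,_; proj₁; proj₂; ∃-syntax)
open import Data.Product.Function.NonDependent.Propositional using (_×-⇔_)
open import Function.Base using (_∘_)
open import Function.Bundles using (_⇔_; mk⇔)
open import Function.Properties.Equivalence using (⇔-setoid)
import Function.Properties.Equivalence as ⇔
open import Level using (0ℓ)
open import Relation.Binary.Core using (_Preserves_⟶_)
open import Relation.Binary.Definitions using (tri<; tri≈; tri>)
open import Relation.Binary.PropositionalEquality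
  using (_≡_; refl; sym; trans; cong; cong₂; subst; module ≡-Reasoning)
open import Relation.Nullary using (¬_; yes; no; contradiction)
open import Relation.Unary using (Pred; Decidable)

data Before : List ℕ → ℕ → ℕ → Set where
  now   : ∀ {j i w} → i ∈ w → Before (j ∷ w) j i
  later : ∀ {j i x w} → Before w j i → Before (x ∷ w) j i

Before-++⁺ : ∀ xs ys zs {j i} → Before (xs ++ j ∷ ys ++ i ∷ zs) j i
Before-++⁺ []       ys zs = now (∈-++⁺ʳ ys (here refl))
Before-++⁺ (x ∷ xs) ys zs = later (Before-++⁺ xs ys zs)

Before-++⁻ : ∀ {w j i} → Before w j i → ∃[ xs ] ∃[ ys ] ∃[ zs ] (w ≡ xs ++ j ∷ ys ++ i ∷ zs)
Before-++⁻ (now i∈w) with ys , zs , refl ← ∈-∃++ i∈w = [] , ys , zs , refl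
Before-++⁻ {x ∷ _} (later b) with xs , ys , zs , refl ← Before-++⁻ b = x ∷ xs , ys , zs , refl

Before-∈ˡ : ∀ {w j i} → Before w j i → j ∈ w
Before-∈ˡ (now _)   = here refl
Before-∈ˡ (later b) = there (Before-∈ˡ b)

Before-∈ʳ : ∀ {w j i} → Before w j i → i ∈ w
Before-∈ʳ (now i∈w) = there i∈w
Before-∈ʳ (later b) = there (Before-∈ʳ b)

Before-concat : ∀ {xs ys j i} → j ∈ xs → i ∈ ys → Before (xs ++ ys) j i
Before-concat {_ ∷ xs} (here refl) i∈ys = now (∈-++⁺ʳ xs i∈ys)
Before-concat (there j∈xs) i∈ys = later (Before-concat j∈xs i∈ys)

module _ {ℓ} {P : Pred ℕ ℓ} (P? : Decidable P) where

  Before-filter⁻ : ∀ {w j i} → Before (filter P? w) j i → Before w j i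
  Before-filter⁻ {x ∷ w} b with P? x
  Before-filter⁻ {x ∷ w} (now i∈) | yes _ = now (proj₁ (∈-filter⁻ P? i∈))
  Before-filter⁻ {x ∷ w} (later b) | yes _ = later (Before-filter⁻ b)
  ... | no _ = later (Before-filter⁻ b)

  Before-filter⁺ : ∀ {w j i} → P j → P i → Before w j i → Before (filter P? w) j i
  Before-filter⁺ {j ∷ w} Pj Pi (now i∈w) with P? j
  ... | yes _  = now (∈-filter⁺ P? i∈w Pi)
  ... | no ¬Pj = contradiction Pj ¬Pj
  Before-filter⁺ {x ∷ w} Pj Pi (later b) with P? x
  ... | yes _ = later (Before-filter⁺ Pj Pi b)
  ... | no _  = Before-filter⁺ Pj Pi b

module _ (f : ℕ → ℕ) where

  Before-map⁺ : ∀ {w j i} → Before w j i → Before (map f w) (f j) (f i)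
  Before-map⁺ (now i∈w) = now (∈-map⁺ f i∈w)
  Before-map⁺ (later b) = later (Before-map⁺ b)

  Before-map⁻ : ∀ {w y z} → Before (map f w) y z →
                ∃[ j ] ∃[ i ] (Before w j i × y ≡ f j × z ≡ f i)
  Before-map⁻ {j ∷ _} (now z∈) with i , i∈w , refl ← ∈-map⁻ f z∈ = j , i , now i∈w , refl , refl
  Before-map⁻ {_ ∷ _} (later b) with j , i , b′ , y≡fj , z≡fi ← Before-map⁻ b = j , i , later b′ , y≡fj , z≡fi

Inv⇒Before : ∀ {w j i} → Inv w j i → Before w j i
Inv⇒Before (_ , xs , ys , zs , refl) = Before-++⁺ xs ys zs

Before⇒Inv : ∀ {w j i} → i < j → Before w j i → Inv w j i
Before⇒Inv i<j b = i<j , Before-++⁻ b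

Inv-∈ˡ : ∀ {w j i} → Inv w j i → j ∈ w
Inv-∈ˡ = Before-∈ˡ ∘ Inv⇒Before

Inv-∈ʳ : ∀ {w j i} → Inv w j i → i ∈ w
Inv-∈ʳ = Before-∈ʳ ∘ Inv⇒Before

module _ {ℓ} {P : Pred ℕ ℓ} (P? : Decidable P) where

  Inv-filter⁻ : ∀ {w j i} → Inv (filter P? w) j i → Inv w j i
  Inv-filter⁻ inv = Before⇒Inv (proj₁ inv) (Before-filter⁻ P? (Inv⇒Before inv))

  Inv-filter⁺ : ∀ {w j i} → P j → P i → Inv w j i → Inv (filter P? w) j i
  Inv-filter⁺ Pj Pi inv = Before⇒Inv (proj₁ inv) (Before-filter⁺ P? Pj Pi (Inv⇒Before inv))

  filter-mono-≤w : ∀ {σ τ} → σ ≤w τ → filter P? σ ≤w filter P? τ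
  filter-mono-≤w {σ} σ≤τ j i inv =
    Inv-filter⁺ (proj₂ (∈-filter⁻ P? {xs = σ} (Inv-∈ˡ inv))) (proj₂ (∈-filter⁻ P? {xs = σ} (Inv-∈ʳ inv)))
                (σ≤τ j i (Inv-filter⁻ inv))

module _ {f : ℕ → ℕ} (f-mono : f Preserves _<_ ⟶ _<_) where

  mono-reflects-< : ∀ {i j} → f i < f j → i < j
  mono-reflects-< {i} {j} fi<fj with <-cmp i j
  ... | tri< i<j _ _ = i<j
  ... | tri≈ _ refl _ = contradiction fi<fj (<-irrefl refl)
  ... | tri> _ _ j<i = contradiction (f-mono j<i) (<-asym fi<fj)

  mono-injective : ∀ {i j} → f i ≡ f j → i ≡ j
  mono-injective {i} {j} fi≡fj with <-cmp i j
  ... | tri< i<j _ _ = contradiction (f-mono i<j) (<-irrefl fi≡fj)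
  ... | tri≈ _ i≡j _ = i≡j
  ... | tri> _ _ j<i = contradiction (f-mono j<i) (<-irrefl (sym fi≡fj))

  Inv-map⁺ : ∀ {w j i} → Inv w j i → Inv (map f w) (f j) (f i)
  Inv-map⁺ inv = Before⇒Inv (f-mono (proj₁ inv)) (Before-map⁺ f (Inv⇒Before inv))

  Inv-map⁻ : ∀ {w j i} → Inv (map f w) (f j) (f i) → Inv w j i
  Inv-map⁻ inv with _ , _ , b , fj≡ , fi≡ ← Before-map⁻ f (Inv⇒Before inv)
    rewrite mono-injective fj≡ | mono-injective fi≡ = Before⇒Inv (mono-reflects-< (proj₁ inv)) b

  map-≤w : ∀ {x y} → (map f x ≤w map f y) ⇔ (x ≤w y)
  map-≤w {x} {y} = mk⇔ reflect preserve
    where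
    reflect : map f x ≤w map f y → x ≤w y
    reflect fx≤fy j i inv = Inv-map⁻ (fx≤fy (f j) (f i) (Inv-map⁺ inv))

    preserve : x ≤w y → map f x ≤w map f y
    preserve x≤y _ _ inv with j , i , _ , refl , refl ← Before-map⁻ f (Inv⇒Before inv) =
      Inv-map⁺ (x≤y j i (Inv-map⁻ inv))

≤w-split : ∀ p {σ τ} →
           (∀ {j i} → j ∈ σ → i ∈ σ → i ≤ p → p < j → Before τ j i) →
           (σ ≤w τ) ⇔ ((restrictLow p σ ≤w restrictLow p τ) × (restrictHigh p σ ≤w restrictHigh p τ))
≤w-split p {σ} {τ} high-before-low =
  mk⇔ (λ σ≤τ → filter-mono-≤w (_≤? p) σ≤τ , filter-mono-≤w (p <?_) σ≤τ)
      (λ (low , high) → combine low high)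
  where
  combine : restrictLow p σ ≤w restrictLow p τ → restrictHigh p σ ≤w restrictHigh p τ → σ ≤w τ
  combine low high j i inv with j ≤? p | p <? i
  ... | yes j≤p | _ = Inv-filter⁻ (_≤? p)
    (low j i (Inv-filter⁺ (_≤? p) j≤p (≤-trans (<⇒≤ (proj₁ inv)) j≤p) inv))
  ... | no _ | yes p<i = Inv-filter⁻ (p <?_)
    (high j i (Inv-filter⁺ (p <?_) (<-trans p<i (proj₁ inv)) p<i inv))
  ... | no j≰p | no p≮i =
    Before⇒Inv (proj₁ inv) (high-before-low (Inv-∈ˡ inv) (Inv-∈ʳ inv) (≮⇒≥ p≮i) (≰⇒> j≰p))

∈-oneTo⁻ : ∀ {m x} → x ∈ oneTo m → 0 < x × x ≤ m
∈-oneTo⁻ x∈ with y , y∈ , refl ← ∈-map⁻ suc x∈ = z<s , ∈-upTo⁻ y∈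

∈-oneTo⁺ : ∀ {m x} → 0 < x → x ≤ m → x ∈ oneTo m
∈-oneTo⁺ {x = suc y} _ x≤m = ∈-map⁺ suc (∈-upTo⁺ x≤m)

∈-perm⁻ : ∀ {m w x} → IsPerm m w → x ∈ w → 0 < x × x ≤ m
∈-perm⁻ w-perm = ∈-oneTo⁻ ∘ ∈-resp-↭ w-perm

∈-perm⁺ : ∀ {m w x} → IsPerm m w → 0 < x → x ≤ m → x ∈ w
∈-perm⁺ w-perm 0<x x≤m = ∈-resp-↭ (↭-sym w-perm) (∈-oneTo⁺ 0<x x≤m)

length-oneTo : ∀ m → length (oneTo m) ≡ m
length-oneTo m = trans (length-map suc (upTo m)) (length-upTo m)

length-perm : ∀ {m w} → IsPerm m w → length w ≡ m
length-perm {m} w-perm = trans (↭-length w-perm) (length-oneTo m)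

All-map-oneTo : ∀ {ℓ} {P : Pred ℕ ℓ} (f : ℕ → ℕ) n →
                (∀ {z} → 0 < z → z ≤ n → P (f z)) → All P (map f (oneTo n))
All-map-oneTo f n Pf = All-map⁺ (All.tabulate λ z∈ → let 0<z , z≤m = ∈-oneTo⁻ z∈ in Pf 0<z z≤m)

oneTo-suc : ∀ n → oneTo (suc n) ≡ oneTo n ++ [ suc n ]
oneTo-suc n = trans (cong (map suc) (sym (upTo-∷ʳ n))) (map-++ suc (upTo n) [ n ])

oneTo-+ : ∀ m n → oneTo (m + n) ≡ oneTo m ++ map (m +_) (oneTo n)
oneTo-+ m 0 = trans (cong oneTo (+-identityʳ m)) (sym (++-identityʳ (oneTo m)))
oneTo-+ m (suc n) = begin
  oneTo (m + suc n)                                    ≡⟨ cong oneTo (+-suc m n) ⟩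
  oneTo (suc (m + n))                                  ≡⟨ oneTo-suc (m + n) ⟩
  oneTo (m + n) ++ [ suc (m + n) ]                     ≡⟨ cong₂ _++_ (oneTo-+ m n) (cong [_] (sym (+-suc m n))) ⟩
  (oneTo m ++ map (m +_) (oneTo n)) ++ [ m + suc n ]   ≡⟨ ++-assoc (oneTo m) _ _ ⟩
  oneTo m ++ map (m +_) (oneTo n) ++ [ m + suc n ]     ≡⟨ cong (oneTo m ++_) (sym (map-++ (m +_) (oneTo n) _)) ⟩
  oneTo m ++ map (m +_) (oneTo n ++ [ suc n ])         ≡⟨ cong (λ w → oneTo m ++ map (m +_) w) (sym (oneTo-suc n)) ⟩
  oneTo m ++ map (m +_) (oneTo (suc n))                ∎
  where open ≡-Reasoning

length-between-oneTo : ∀ p r d →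
  length (filter (_<? suc (p + r)) (filter (p <?_) (oneTo (p + r + d)))) ≡ r
length-between-oneTo p r d = begin
  length (filter (_<? suc (p + r)) (filter (p <?_) (oneTo (p + r + d))))
    ≡⟨ cong (length ∘ filter (_<? suc (p + r)) ∘ filter (p <?_)) split ⟩
  length (filter (_<? suc (p + r)) (filter (p <?_) (oneTo p ++ middle ++ top)))
    ≡⟨ cong (length ∘ filter (_<? suc (p + r))) drop-bottom ⟩
  length (filter (_<? suc (p + r)) (middle ++ top))
    ≡⟨ cong length keep-middle ⟩
  length middle
    ≡⟨ trans (length-map (p +_) (oneTo r)) (length-oneTo r) ⟩
  r ∎
  where
  open ≡-Reasoning
  middle top : List ℕ
  middle = map (p +_) (oneTo r)
  top    = map (p + r +_) (oneTo d)

  split : oneTo (p + r + d) ≡ oneTo p ++ middle ++ top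
  split = trans (oneTo-+ (p + r) d)
                (trans (cong (_++ top) (oneTo-+ p r)) (++-assoc (oneTo p) middle top))

  bottom-≤ : All (λ y → ¬ p < y) (oneTo p)
  bottom-≤ = All.tabulate (≤⇒≯ ∘ proj₂ ∘ ∈-oneTo⁻)

  middle-> : All (p <_) middle
  middle-> = All-map-oneTo (p +_) r (λ 0<z _ → m<m+n p 0<z)

  middle-< : All (_< suc (p + r)) middle
  middle-< = All-map-oneTo (p +_) r (λ _ z≤r → s≤s (+-monoʳ-≤ p z≤r))

  top-> : All (λ y → p + r < y) top
  top-> = All-map-oneTo (p + r +_) d (λ 0<z _ → m<m+n (p + r) 0<z)

  drop-bottom : filter (p <?_) (oneTo p ++ middle ++ top) ≡ middle ++ top
  drop-bottom = begin
    filter (p <?_) (oneTo p ++ middle ++ top)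
      ≡⟨ filter-++ (p <?_) (oneTo p) (middle ++ top) ⟩
    filter (p <?_) (oneTo p) ++ filter (p <?_) (middle ++ top)
      ≡⟨ cong₂ _++_ (filter-none (p <?_) bottom-≤)
                    (filter-all (p <?_) (++⁺ middle-> (All.map (≤-<-trans (m≤m+n p r)) top->))) ⟩
    middle ++ top ∎

  keep-middle : filter (_<? suc (p + r)) (middle ++ top) ≡ middle
  keep-middle = begin
    filter (_<? suc (p + r)) (middle ++ top)
      ≡⟨ filter-++ (_<? suc (p + r)) middle top ⟩
    filter (_<? suc (p + r)) middle ++ filter (_<? suc (p + r)) top
      ≡⟨ cong₂ _++_ (filter-all (_<? suc (p + r)) middle-<) (filter-none (_<? suc (p + r)) (All.map ≤⇒≯ top->)) ⟩
    middle ++ []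
      ≡⟨ ++-identityʳ middle ⟩
    middle ∎

letters-between : ∀ {p q σ x} → IsPerm (p + q) σ → x ∈ restrictHigh p σ →
                  suc (length (filter (_<? x) (restrictHigh p σ))) ≡ x ∸ p
letters-between {p} {q} {σ} σ-perm x∈high
  with x∈σ , p<x ← ∈-filter⁻ (p <?_) {xs = σ} x∈high
  with r , refl ← m≤n⇒∃[o]m+o≡n p<x
  with d , p+r+d≡p+q ← m≤n⇒∃[o]m+o≡n (<⇒≤ (proj₂ (∈-perm⁻ σ-perm x∈σ))) = begin
  suc (length (filter (_<? suc (p + r)) (filter (p <?_) σ)))
    ≡⟨ cong suc (↭-length (filter-↭ (_<? suc (p + r)) (filter-↭ (p <?_) σ-perm))) ⟩
  suc (length (filter (_<? suc (p + r)) (filter (p <?_) (oneTo (p + q)))))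
    ≡⟨ cong (λ n → suc (length (filter (_<? suc (p + r)) (filter (p <?_) (oneTo n))))) (sym p+r+d≡p+q) ⟩
  suc (length (filter (_<? suc (p + r)) (filter (p <?_) (oneTo (p + r + d)))))
    ≡⟨ cong suc (length-between-oneTo p r d) ⟩
  suc r
    ≡⟨ sym (m+n∸m≡n p (suc r)) ⟩
  p + suc r ∸ p
    ≡⟨ cong (_∸ p) (+-suc p r) ⟩
  suc (p + r) ∸ p ∎
  where open ≡-Reasoning

st-restrictHigh : ∀ {p q σ} → IsPerm (p + q) σ → st (restrictHigh p σ) ≡ map (_∸ p) (restrictHigh p σ)
st-restrictHigh σ-perm = map-cong-local (All.tabulate (letters-between σ-perm))

restrictHigh≡shift-st : ∀ {p q σ} → IsPerm (p + q) σ →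
                        restrictHigh p σ ≡ map (_+ p) (st (restrictHigh p σ))
restrictHigh≡shift-st {p} {q} {σ} σ-perm = sym (begin
  map (_+ p) (st (restrictHigh p σ))             ≡⟨ cong (map (_+ p)) (st-restrictHigh σ-perm) ⟩
  map (_+ p) (map (_∸ p) (restrictHigh p σ))     ≡⟨ map-∘ (restrictHigh p σ) ⟨
  map (λ x → x ∸ p + p) (restrictHigh p σ)       ≡⟨ map-id-local (All.tabulate (λ x∈ →
                                                     m∸n+n≡m (<⇒≤ (proj₂ (∈-filter⁻ (p <?_) {xs = σ} x∈))))) ⟩
  restrictHigh p σ                               ∎)
  where open ≡-Reasoning

module _ {p q u v} (u-perm : IsPerm p u) (v-perm : IsPerm q v) where

  △-shift : v △ u ≡ map (_+ p) v ++ u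
  △-shift = cong (λ n → map (_+ n) v ++ u) (length-perm u-perm)

  private
    shifted-v-high : All (p <_) (map (_+ p) v)
    shifted-v-high = All-map⁺ (All.tabulate (λ y∈v → +-monoˡ-< p (proj₁ (∈-perm⁻ v-perm y∈v))))

    u-low : All (_≤ p) u
    u-low = All.tabulate (proj₂ ∘ ∈-perm⁻ u-perm)

  restrictLow-△ : restrictLow p (v △ u) ≡ u
  restrictLow-△ = begin
    restrictLow p (v △ u)                                     ≡⟨ cong (restrictLow p) △-shift ⟩
    filter (_≤? p) (map (_+ p) v ++ u)                         ≡⟨ filter-++ (_≤? p) (map (_+ p) v) u ⟩
    filter (_≤? p) (map (_+ p) v) ++ filter (_≤? p) u          ≡⟨ cong₂ _++_ (filter-none (_≤? p) (All.map <⇒≱ shifted-v-high))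
                                                                              (filter-all (_≤? p) u-low) ⟩
    u                                                          ∎
    where open ≡-Reasoning

  restrictHigh-△ : restrictHigh p (v △ u) ≡ map (_+ p) v
  restrictHigh-△ = begin
    restrictHigh p (v △ u)                                    ≡⟨ cong (restrictHigh p) △-shift ⟩
    filter (p <?_) (map (_+ p) v ++ u)                         ≡⟨ filter-++ (p <?_) (map (_+ p) v) u ⟩
    filter (p <?_) (map (_+ p) v) ++ filter (p <?_) u          ≡⟨ cong₂ _++_ (filter-all (p <?_) shifted-v-high)
                                                                              (filter-none (p <?_) (All.map ≤⇒≯ u-low)) ⟩
    map (_+ p) v ++ []                                         ≡⟨ ++-identityʳ _ ⟩
    map (_+ p) v                                               ∎
    where open ≡-Reasoning

  △-high-before-low : ∀ {σ} → IsPerm (p + q) σ →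
                      ∀ {j i} → j ∈ σ → i ∈ σ → i ≤ p → p < j → Before (v △ u) j i
  △-high-before-low σ-perm {j} j∈σ i∈σ i≤p p<j rewrite △-shift =
    Before-concat j∈shifted-v (∈-perm⁺ u-perm (proj₁ (∈-perm⁻ σ-perm i∈σ)) i≤p)
    where
    j∸p∈v : j ∸ p ∈ v
    j∸p∈v = ∈-perm⁺ v-perm (m<n⇒0<n∸m p<j) (m≤n+o⇒m∸n≤o j p (proj₂ (∈-perm⁻ σ-perm j∈σ)))

    j∈shifted-v : j ∈ map (_+ p) v
    j∈shifted-v = subst (_∈ map (_+ p) v) (m∸n+n≡m (<⇒≤ p<j)) (∈-map⁺ (_+ p) j∸p∈v)

lemma3p2 : (p q : ℕ) (σ : List ℕ) → IsPerm (p + q) σ →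
           (u v : List ℕ) → IsPerm p u → IsPerm q v →
           (σ ≤w (v △ u)) ⇔ ((restrictLow p σ ≤w u) × (st (restrictHigh p σ) ≤w v))
lemma3p2 p q σ σ-perm u v u-perm v-perm = begin
  σ ≤w (v △ u)
    ≈⟨ ≤w-split p (△-high-before-low u-perm v-perm σ-perm) ⟩
  ((restrictLow p σ ≤w restrictLow p (v △ u)) × (restrictHigh p σ ≤w restrictHigh p (v △ u)))
    ≡⟨ cong₂ (λ low high → (restrictLow p σ ≤w low) × (restrictHigh p σ ≤w high))
             (restrictLow-△ u-perm v-perm) (restrictHigh-△ u-perm v-perm) ⟩
  ((restrictLow p σ ≤w u) × (restrictHigh p σ ≤w map (_+ p) v))
    ≡⟨ cong (λ high → (restrictLow p σ ≤w u) × (high ≤w map (_+ p) v)) (restrictHigh≡shift-st σ-perm) ⟩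
  ((restrictLow p σ ≤w u) × (map (_+ p) (st (restrictHigh p σ)) ≤w map (_+ p) v))
    ≈⟨ ⇔.refl ×-⇔ map-≤w (+-monoˡ-< p) ⟩
  ((restrictLow p σ ≤w u) × (st (restrictHigh p σ) ≤w v)) ∎
  where open import Relation.Binary.Reasoning.Setoid (⇔-setoid 0ℓ)
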